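{- Let $q=2^{2m+1}$ with $m\geqslant 0$ an integer and $\ell=2^{m+1}$. For each $\kappa\in\mathbb{F}_q^\times$, the system of equations \[ \kappa a=a^2,\qquad \kappa^{\ell+1}b=b^2,\qquad \kappa^{\ell+2}c=c^2,\qquad c=ab+a^{\ell+2}+b^\ell \] has exactly four solutions $(a,b,c)\in\mathbb{F}_q^3$. -}

module Defs where

open import Level using (Level; _⊔_) renaming (suc to lsuc)
open import Data.Nat using (ℕ; zero; suc)
open import Data.Fin using (Fin)
open import Data.Product using (Σ; ∃; _×_; _,_)
open import Relation.Nullary using (¬_)
open import Relation.Binary.PropositionalEquality using (_≡_)
open import Algebra.Bundles using (CommutativeRing)

module _ {c ℓ : Level} (R : CommutativeRing c ℓ) where
  open CommutativeRing R

  pow : Carrier → ℕ → Carrier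
  pow x zero    = 1#
  pow x (suc n) = x * pow x n

  record IsField : Set (c ⊔ ℓ) where
    field
      1≉0     : ¬ (1# ≈ 0#)
      inverse : ∀ x → ¬ (x ≈ 0#) → Σ Carrier (λ y → (x * y) ≈ 1#)

  record HasCardinality (q : ℕ) : Set (c ⊔ ℓ) where
    field
      enum       : Fin q → Carrier
      enum-inj   : ∀ i j → enum i ≈ enum j → i ≡ j
      enum-surj  : ∀ x → Σ (Fin q) (λ i → enum i ≈ x)

  record IsFiniteFieldOfOrder (q : ℕ) : Set (c ⊔ ℓ) where
    field
      isField : IsField
      card    : HasCardinality q

  Triple : Set c
  Triple = Carrier × Carrier × Carrier

  _≈³_ : Triple → Triple → Set ℓ
  (a , b , c') ≈³ (a' , b' , c'') = (a ≈ a') × (b ≈ b') × (c' ≈ c'')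

  ExactlyNSolutions : ℕ → (Triple → Set ℓ) → Set (c ⊔ ℓ)
  ExactlyNSolutions n P =
    Σ (Fin n → Triple) λ v →
      (∀ i → P (v i)) ×
      (∀ i j → v i ≈³ v j → i ≡ j) ×
      (∀ t → P t → Σ (Fin n) (λ i → v i ≈³ t))

  System : ℕ → Carrier → Triple → Set ℓ
  System l κ (a , b , c') =
    ((κ * a) ≈ (a * a)) ×
    ((pow κ (suc l) * b) ≈ (b * b)) ×
    ((pow κ (suc (suc l)) * c') ≈ (c' * c')) ×
    (c' ≈ ((a * b + pow a (suc (suc l))) + pow b l))

-- A field of order 2^(2m+1) has characteristic 2, and every nonzero κ satisfies κ^q = κ (Fermat: multiplication
-- by κ permutes the field). The first two equations force a ∈ {0, κ} and b ∈ {0, κ^(ℓ+1)}, and the fourth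
-- determines c. As ℓ² = 2q, (κ^(ℓ+1))^ℓ = κ^ℓ (κ^q)² = κ^(ℓ+2); hence in each of the four cases c is 0 or
-- κ^(ℓ+2) (for a = κ, b = κ^(ℓ+1) the value is 3 κ^(ℓ+2) = κ^(ℓ+2)), so c satisfies the third equation too.
module Submission where

open import Level using (Level)
open import Data.Nat as ℕ using (ℕ; zero; suc; NonZero)
import Data.Nat.Properties as ℕ
open import Data.Fin as Fin using (Fin; zero; suc; remQuot; combine)
open import Data.Fin.Properties using (remQuot-combine; combine-remQuot)
open import Data.Fin.Permutation using (Permutation; permutation; _⟨$⟩ʳ_)
open import Data.Vec.Functional using (updateAt; replicate)
open import Data.Vec.Functional.Properties using (updateAt-updates; updateAt-minimal)
open import Data.Product using (Σ; _,_; proj₁; proj₂; uncurry)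
open import Function using (const)
open import Relation.Binary.Definitions using (Decidable)
open import Relation.Nullary using (¬_; yes; no; contradiction)
open import Relation.Nullary.Decidable using (decidable-stable)
open import Relation.Binary.PropositionalEquality as ≡ using (_≡_; _≢_)
open import Algebra.Bundles using (Monoid; CommutativeRing)
import Algebra.Properties.Monoid.Sum as MonoidSum
import Algebra.Properties.CommutativeMonoid.Sum as CommutativeMonoidSum
open import Defs

remQuot-injective : ∀ {m} n {i j : Fin (m ℕ.* n)} → remQuot {m} n i ≡ remQuot n j → i ≡ j
remQuot-injective {m} n {i} {j} eq = begin
  i                                  ≡⟨ combine-remQuot {m} n i ⟨
  uncurry combine (remQuot {m} n i)  ≡⟨ ≡.cong (uncurry combine) eq ⟩
  uncurry combine (remQuot {m} n j)  ≡⟨ combine-remQuot {m} n j ⟩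
  j                                  ∎
  where open ≡.≡-Reasoning

module _ {a ℓ : Level} (M : Monoid a ℓ) where
  open Monoid M
  open MonoidSum M using (sum; sum-replicate-zero)

  sum-updateAt-replicate-ε : ∀ {n} (i : Fin n) x → sum (updateAt (replicate n ε) i (const x)) ≈ x
  sum-updateAt-replicate-ε {suc n} zero    x = trans (∙-congˡ (sum-replicate-zero n)) (identityʳ x)
  sum-updateAt-replicate-ε {suc n} (suc i) x = trans (identityˡ _) (sum-updateAt-replicate-ε i x)

module _ {c ℓ : Level} (F : CommutativeRing c ℓ) where
  open CommutativeRing F hiding (zero)
  open import Algebra.Properties.Ring ring using (+-identityʳ-unique)
  open import Algebra.Properties.Semiring.Exp semiring using (_^_; ^-congˡ; ^-homo-*; ^-assocʳ)
  open import Algebra.Properties.Semiring.Mult semiring using (_×_; ×-congʳ; ×-assoc-*; ×1-homo-*)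
  open CommutativeMonoidSum +-commutativeMonoid using (sum; ∑-distrib-+; sum-cong-≋; sum-permute; sum-replicate)
  open CommutativeMonoidSum *-commutativeMonoid using ()
    renaming (sum to product; ∑-distrib-+ to ∏-distrib-*; sum-cong-≋ to product-cong-≋;
              sum-permute to product-permute; sum-replicate to product-replicate)
  open import Relation.Binary.Reasoning.Setoid setoid

  pow≡^ : ∀ x n → pow F x n ≡ x ^ n
  pow≡^ x zero    = ≡.refl
  pow≡^ x (suc n) = ≡.cong (x *_) (pow≡^ x n)

  pow-congˡ : ∀ n {x y} → x ≈ y → pow F x n ≈ pow F y n
  pow-congˡ n {x} {y} x≈y = begin
    pow F x n  ≡⟨ pow≡^ x n ⟩
    x ^ n      ≈⟨ ^-congˡ n x≈y ⟩
    y ^ n      ≡⟨ pow≡^ y n ⟨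
    pow F y n  ∎

  pow-zeroˡ : ∀ n .⦃ _ : NonZero n ⦄ → pow F 0# n ≈ 0#
  pow-zeroˡ (suc n) = zeroˡ (pow F 0# n)

  module Enumeration {n : ℕ} (card : HasCardinality F n) where
    open HasCardinality card

    index : Carrier → Fin n
    index x = proj₁ (enum-surj x)

    enum-index : ∀ x → enum (index x) ≈ x
    enum-index x = proj₂ (enum-surj x)

    index-unique : ∀ {x i} → x ≈ enum i → index x ≡ i
    index-unique {x} x≈enum = enum-inj _ _ (trans (enum-index x) x≈enum)

    _≟_ : Decidable _≈_
    x ≟ y with index x Fin.≟ index y
    ... | yes eq = yes (trans (sym (enum-index x)) (trans (reflexive (≡.cong enum eq)) (enum-index y)))
    ... | no neq = no (λ x≈y → neq (index-unique (trans x≈y (sym (enum-index y)))))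

    permutationOf : (h h⁻¹ : Carrier → Carrier) →
                    (∀ {x y} → x ≈ y → h x ≈ h y) → (∀ {x y} → x ≈ y → h⁻¹ x ≈ h⁻¹ y) →
                    (∀ x → h (h⁻¹ x) ≈ x) → (∀ x → h⁻¹ (h x) ≈ x) → Permutation n n
    permutationOf h h⁻¹ h-cong h⁻¹-cong h∘h⁻¹ h⁻¹∘h =
      permutation (λ i → index (h (enum i))) (λ i → index (h⁻¹ (enum i)))
        (λ i → index-unique (trans (h-cong (enum-index _)) (h∘h⁻¹ _)))
        (λ i → index-unique (trans (h⁻¹-cong (enum-index _)) (h⁻¹∘h _)))

    card×1≈0 : n × 1# ≈ 0#
    card×1≈0 = +-identityʳ-unique (sum enum) (n × 1#) (sym (begin
      sum enum                              ≈⟨ sum-permute enum shift ⟩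
      sum (λ i → enum (shift ⟨$⟩ʳ i))        ≈⟨ sum-cong-≋ {n} (λ i → enum-index _) ⟩
      sum (λ i → enum i + 1#)               ≈⟨ ∑-distrib-+ enum (λ _ → 1#) ⟩
      sum enum + sum (replicate n 1#)       ≈⟨ +-congˡ (sum-replicate n) ⟩
      sum enum + n × 1#                     ∎))
      where
      shift : Permutation n n
      shift = permutationOf (_+ 1#) (_+ - 1#) +-congʳ +-congʳ
        (λ x → trans (+-assoc x _ _) (trans (+-congˡ (-‿inverseˡ 1#)) (+-identityʳ x)))
        (λ x → trans (+-assoc x _ _) (trans (+-congˡ (-‿inverseʳ 1#)) (+-identityʳ x)))

  [m^k]×1≈[m×1]^k : ∀ m k → (m ℕ.^ k) × 1# ≈ (m × 1#) ^ k
  [m^k]×1≈[m×1]^k m zero    = +-identityʳ 1#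
  [m^k]×1≈[m×1]^k m (suc k) = trans (×1-homo-* m (m ℕ.^ k)) (*-congˡ ([m^k]×1≈[m×1]^k m k))

  rootOf : Carrier → Fin 2 → Carrier
  rootOf k zero       = 0#
  rootOf k (suc zero) = k

  rootOf-root : ∀ k i → k * rootOf k i ≈ rootOf k i * rootOf k i
  rootOf-root k zero       = trans (zeroʳ k) (sym (zeroʳ 0#))
  rootOf-root k (suc zero) = refl

  rootOf-injective : ∀ {k} → k ≉ 0# → ∀ i j → rootOf k i ≈ rootOf k j → i ≡ j
  rootOf-injective k≉0 zero       zero       _   = ≡.refl
  rootOf-injective k≉0 zero       (suc zero) 0≈k = contradiction (sym 0≈k) k≉0
  rootOf-injective k≉0 (suc zero) zero       k≈0 = contradiction k≈0 k≉0
  rootOf-injective k≉0 (suc zero) (suc zero) _   = ≡.refl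

  module FieldProperties (isField : IsField F) where
    open IsField isField

    x⁻¹*[x*y]≈y : ∀ {x} (x≉0 : x ≉ 0#) y → proj₁ (inverse x x≉0) * (x * y) ≈ y
    x⁻¹*[x*y]≈y {x} x≉0 y = begin
      x⁻¹ * (x * y)  ≈⟨ sym (*-assoc x⁻¹ x y) ⟩
      (x⁻¹ * x) * y  ≈⟨ *-congʳ (trans (*-comm x⁻¹ x) (proj₂ (inverse x x≉0))) ⟩
      1# * y         ≈⟨ *-identityˡ y ⟩
      y              ∎
      where x⁻¹ = proj₁ (inverse x x≉0)

    x*[x⁻¹*y]≈y : ∀ {x} (x≉0 : x ≉ 0#) y → x * (proj₁ (inverse x x≉0) * y) ≈ y
    x*[x⁻¹*y]≈y {x} x≉0 y = begin
      x * (x⁻¹ * y)  ≈⟨ sym (*-assoc x x⁻¹ y) ⟩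
      (x * x⁻¹) * y  ≈⟨ *-congʳ (proj₂ (inverse x x≉0)) ⟩
      1# * y         ≈⟨ *-identityˡ y ⟩
      y              ∎
      where x⁻¹ = proj₁ (inverse x x≉0)

    *-cancelˡ-nonzero : ∀ {x y z} → x ≉ 0# → x * y ≈ x * z → y ≈ z
    *-cancelˡ-nonzero {x} {y} {z} x≉0 xy≈xz =
      trans (sym (x⁻¹*[x*y]≈y x≉0 y)) (trans (*-congˡ xy≈xz) (x⁻¹*[x*y]≈y x≉0 z))

    *-cancelʳ-nonzero : ∀ {x y z} → x ≉ 0# → y * x ≈ z * x → y ≈ z
    *-cancelʳ-nonzero {x} {y} {z} x≉0 yx≈zx =
      *-cancelˡ-nonzero x≉0 (trans (*-comm x y) (trans yx≈zx (*-comm z x)))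

    x*y≈0⇒y≈0 : ∀ {x y} → x ≉ 0# → x * y ≈ 0# → y ≈ 0#
    x*y≈0⇒y≈0 {x} x≉0 xy≈0 = *-cancelˡ-nonzero x≉0 (trans xy≈0 (sym (zeroʳ x)))

    *-nonzero : ∀ {x y} → x ≉ 0# → y ≉ 0# → x * y ≉ 0#
    *-nonzero x≉0 y≉0 xy≈0 = y≉0 (x*y≈0⇒y≈0 x≉0 xy≈0)

    ^-nonzero : ∀ {x} n → x ≉ 0# → x ^ n ≉ 0#
    ^-nonzero zero    x≉0 = 1≉0
    ^-nonzero (suc n) x≉0 = *-nonzero x≉0 (^-nonzero n x≉0)

    product-nonzero : ∀ {n} (f : Fin n → Carrier) → (∀ i → f i ≉ 0#) → product f ≉ 0#
    product-nonzero {zero}  f f≉0 = 1≉0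
    product-nonzero {suc n} f f≉0 =
      *-nonzero (f≉0 zero) (product-nonzero (λ i → f (suc i)) (λ i → f≉0 (suc i)))

    rootOf-surjective : Decidable _≈_ → ∀ {k x} → k * x ≈ x * x → Σ (Fin 2) λ i → rootOf k i ≈ x
    rootOf-surjective _≟_ {k} {x} kx≈xx with x ≟ 0#
    ... | yes x≈0 = zero , sym x≈0
    ... | no x≉0  = suc zero , *-cancelʳ-nonzero x≉0 kx≈xx

  module FiniteField (isField : IsField F) {n : ℕ} (card : HasCardinality F n) where
    open FieldProperties isField
    open Enumeration card
    open HasCardinality card
    open IsField isField

    -- Multiplication by x permutes the elements and fixes 0. In the product, f replaces the element 0 by 1
    -- so that it can be cancelled, and u supplies the factor x that the fixed point 0 does not absorb.
    fermat : ∀ {x} → x ≉ 0# → x ^ n ≈ x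
    fermat {x} x≉0 = *-cancelʳ-nonzero (product-nonzero f f≉0) (begin
      x ^ n * product f                        ≈⟨ *-congʳ (sym (product-replicate n)) ⟩
      product (replicate n x) * product f      ≈⟨ sym (∏-distrib-* (replicate n x) f) ⟩
      product (λ i → x * f i)                  ≈⟨ product-cong-≋ {n} scale ⟩
      product (λ i → u i * f (π ⟨$⟩ʳ i))        ≈⟨ ∏-distrib-* u (λ i → f (π ⟨$⟩ʳ i)) ⟩
      product u * product (λ i → f (π ⟨$⟩ʳ i))  ≈⟨ *-cong (sum-updateAt-replicate-ε *-monoid o x)
                                                           (sym (product-permute f π)) ⟩
      x * product f                            ∎)
      where
      o : Fin n
      o = index 0#

      f u : Fin n → Carrier
      f = updateAt enum o (const 1#)
      u = updateAt (replicate n 1#) o (const x)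

      π : Permutation n n
      π = permutationOf (x *_) (proj₁ (inverse x x≉0) *_) *-congˡ *-congˡ
        (x*[x⁻¹*y]≈y x≉0) (x⁻¹*[x*y]≈y x≉0)

      enum≉0 : ∀ {i} → i ≢ o → enum i ≉ 0#
      enum≉0 i≢o enum≈0 = i≢o (≡.sym (index-unique (sym enum≈0)))

      f≉0 : ∀ i → f i ≉ 0#
      f≉0 i with i Fin.≟ o
      ... | yes ≡.refl = λ fo≈0 → 1≉0 (trans (reflexive (≡.sym (updateAt-updates o enum))) fo≈0)
      ... | no i≢o = λ fi≈0 → enum≉0 i≢o (trans (reflexive (≡.sym (updateAt-minimal i o enum i≢o))) fi≈0)

      scale : ∀ i → x * f i ≈ u i * f (π ⟨$⟩ʳ i)
      scale i with i Fin.≟ o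
      ... | yes ≡.refl = begin
        x * f o                ≡⟨ ≡.cong (_* f o) (updateAt-updates o (replicate n 1#)) ⟨
        u o * f o              ≡⟨ ≡.cong (λ j → u o * f j) πo≡o ⟨
        u o * f (π ⟨$⟩ʳ o)      ∎
        where
        πo≡o : π ⟨$⟩ʳ o ≡ o
        πo≡o = index-unique (trans (*-congˡ (enum-index 0#)) (trans (zeroʳ x) (sym (enum-index 0#))))
      ... | no i≢o = begin
        x * f i                ≡⟨ ≡.cong (x *_) (updateAt-minimal i o enum i≢o) ⟩
        x * enum i             ≈⟨ enum-index _ ⟨
        enum (π ⟨$⟩ʳ i)         ≡⟨ updateAt-minimal (π ⟨$⟩ʳ i) o enum πi≢o ⟨
        f (π ⟨$⟩ʳ i)            ≈⟨ *-identityˡ _ ⟨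
        1# * f (π ⟨$⟩ʳ i)       ≡⟨ ≡.cong (_* f (π ⟨$⟩ʳ i)) (updateAt-minimal i o (replicate n 1#) i≢o) ⟨
        u i * f (π ⟨$⟩ʳ i)      ∎
        where
        πi≢o : π ⟨$⟩ʳ i ≢ o
        πi≢o πi≡o = enum≉0 i≢o (x*y≈0⇒y≈0 x≉0
          (trans (sym (enum-index _)) (trans (reflexive (≡.cong enum πi≡o)) (enum-index 0#))))

  m^k-order⇒m×1≈0 : IsField F → ∀ m k → HasCardinality F (m ℕ.^ k) → m × 1# ≈ 0#
  m^k-order⇒m×1≈0 isField m k card = decidable-stable ((m × 1#) ≟ 0#) λ m×1≉0 →
    ^-nonzero k m×1≉0 (begin
      (m × 1#) ^ k    ≈⟨ [m^k]×1≈[m×1]^k m k ⟨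
      (m ℕ.^ k) × 1#  ≈⟨ card×1≈0 ⟩
      0#              ∎)
    where
    open FieldProperties isField
    open Enumeration card

  ^[1+ℓ]^ℓ≈^[2+ℓ] : ∀ {x} q ℓ → x ^ q ≈ x → ℓ ℕ.* ℓ ≡ q ℕ.* 2 → (x ^ suc ℓ) ^ ℓ ≈ x ^ suc (suc ℓ)
  ^[1+ℓ]^ℓ≈^[2+ℓ] {x} q ℓ xᵠ≈x ℓ²≡2q = begin
    (x ^ suc ℓ) ^ ℓ        ≈⟨ ^-assocʳ x (suc ℓ) ℓ ⟩
    x ^ (ℓ ℕ.+ ℓ ℕ.* ℓ)    ≈⟨ ^-homo-* x ℓ (ℓ ℕ.* ℓ) ⟩
    x ^ ℓ * x ^ (ℓ ℕ.* ℓ)  ≡⟨ ≡.cong (λ e → x ^ ℓ * x ^ e) ℓ²≡2q ⟩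
    x ^ ℓ * x ^ (q ℕ.* 2)  ≈⟨ *-congˡ (^-assocʳ x q 2) ⟨
    x ^ ℓ * (x ^ q) ^ 2    ≈⟨ *-congˡ (^-congˡ 2 xᵠ≈x) ⟩
    x ^ ℓ * x ^ 2          ≈⟨ *-comm (x ^ ℓ) (x ^ 2) ⟩
    x ^ 2 * x ^ ℓ          ≈⟨ ^-homo-* x 2 ℓ ⟨
    x ^ suc (suc ℓ)        ∎

  module Solutions (isField : IsField F) (_≟_ : Decidable _≈_) (char2 : 2 × 1# ≈ 0#)
                   (l : ℕ) .⦃ _ : NonZero l ⦄ {κ : Carrier} (κ≉0 : κ ≉ 0#)
                   (frobenius : (κ ^ suc l) ^ l ≈ κ ^ suc (suc l)) where
    open FieldProperties isField

    β X : Carrier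
    β = pow F κ (suc l)
    X = pow F κ (suc (suc l))

    cOf : Carrier → Carrier → Carrier
    cOf a b = (a * b + pow F a (suc (suc l))) + pow F b l

    cOf-cong : ∀ {a a′ b b′} → a ≈ a′ → b ≈ b′ → cOf a b ≈ cOf a′ b′
    cOf-cong a≈a′ b≈b′ =
      +-cong (+-cong (*-cong a≈a′ b≈b′) (pow-congˡ (suc (suc l)) a≈a′)) (pow-congˡ l b≈b′)

    x+x≈0 : ∀ x → x + x ≈ 0#
    x+x≈0 x = begin
      x + x          ≈⟨ +-congˡ (+-identityʳ x) ⟨
      2 × x          ≈⟨ ×-congʳ 2 (*-identityˡ x) ⟨
      2 × (1# * x)   ≈⟨ ×-assoc-* 2 1# x ⟨
      (2 × 1#) * x   ≈⟨ *-congʳ char2 ⟩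
      0# * x         ≈⟨ zeroˡ x ⟩
      0#             ∎

    β^l≈X : pow F β l ≈ X
    β^l≈X = begin
      pow F β l          ≡⟨ ≡.trans (pow≡^ β l) (≡.cong (_^ l) (pow≡^ κ (suc l))) ⟩
      (κ ^ suc l) ^ l    ≈⟨ frobenius ⟩
      κ ^ suc (suc l)    ≡⟨ pow≡^ κ (suc (suc l)) ⟨
      X                  ∎

    β≉0 : β ≉ 0#
    β≉0 β≈0 = ^-nonzero (suc l) κ≉0 (trans (reflexive (≡.sym (pow≡^ κ (suc l)))) β≈0)

    cOf-roots : ∀ i j → Σ (Fin 2) λ k → cOf (rootOf κ i) (rootOf β j) ≈ rootOf X k
    cOf-roots zero zero = zero , (begin
      (0# * 0# + pow F 0# (suc (suc l))) + pow F 0# l  ≈⟨ +-cong (+-cong (zeroˡ 0#) (pow-zeroˡ (suc (suc l))))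
                                                                 (pow-zeroˡ l) ⟩
      (0# + 0#) + 0#                                  ≈⟨ trans (+-identityʳ _) (+-identityʳ 0#) ⟩
      0#                                              ∎)
    cOf-roots (suc zero) zero = suc zero , (begin
      (κ * 0# + X) + pow F 0# l  ≈⟨ +-cong (+-congʳ (zeroʳ κ)) (pow-zeroˡ l) ⟩
      (0# + X) + 0#              ≈⟨ trans (+-identityʳ _) (+-identityˡ X) ⟩
      X                          ∎)
    cOf-roots zero (suc zero) = suc zero , (begin
      (0# * β + pow F 0# (suc (suc l))) + pow F β l  ≈⟨ +-cong (+-cong (zeroˡ β) (pow-zeroˡ (suc (suc l))))
                                                               β^l≈X ⟩
      (0# + 0#) + X                                 ≈⟨ trans (+-congʳ (+-identityʳ 0#)) (+-identityˡ X) ⟩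
      X                                             ∎)
    cOf-roots (suc zero) (suc zero) = suc zero , (begin
      (X + X) + pow F β l  ≈⟨ +-cong (x+x≈0 X) β^l≈X ⟩
      0# + X               ≈⟨ +-identityˡ X ⟩
      X                    ∎)

    solution : Fin 2 → Fin 2 → Triple F
    solution i j = rootOf κ i , rootOf β j , cOf (rootOf κ i) (rootOf β j)

    solution-sound : ∀ i j → System F l κ (solution i j)
    solution-sound i j = rootOf-root κ i , rootOf-root β j , X*c≈c*c , refl
      where
      cᵢⱼ : Carrier
      cᵢⱼ = cOf (rootOf κ i) (rootOf β j)
      X*c≈c*c : X * cᵢⱼ ≈ cᵢⱼ * cᵢⱼ
      X*c≈c*c with cOf-roots i j
      ... | k , c≈r = trans (*-congˡ c≈r) (trans (rootOf-root X k) (sym (*-cong c≈r c≈r)))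

    solution-complete : ∀ t → System F l κ t → Σ (Fin 2) λ i → Σ (Fin 2) λ j → _≈³_ F (solution i j) t
    solution-complete (a , b , c) (κa≈aa , βb≈bb , _ , c≈cOf)
      with rootOf-surjective _≟_ κa≈aa | rootOf-surjective _≟_ βb≈bb
    ... | i , rᵢ≈a | j , rⱼ≈b = i , j , rᵢ≈a , rⱼ≈b , sym (trans c≈cOf (cOf-cong (sym rᵢ≈a) (sym rⱼ≈b)))

    -- An index in Fin 4 = Fin (2 * 2) is read, via remQuot, as the pair of root indices of a and b.
    exactlyFour : ExactlyNSolutions F 4 (System F l κ)
    exactlyFour = v , sound , distinct , complete
      where
      v : Fin 4 → Triple F
      v t = uncurry solution (remQuot {2} 2 t)

      sound : ∀ t → System F l κ (v t)
      sound t = solution-sound (proj₁ (remQuot {2} 2 t)) (proj₂ (remQuot {2} 2 t))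

      distinct : ∀ t t′ → _≈³_ F (v t) (v t′) → t ≡ t′
      distinct t t′ (a≈a′ , b≈b′ , _) = remQuot-injective {2} 2 (≡.cong₂ _,_
        (rootOf-injective κ≉0 (proj₁ (remQuot {2} 2 t)) (proj₁ (remQuot {2} 2 t′)) a≈a′)
        (rootOf-injective β≉0 (proj₂ (remQuot {2} 2 t)) (proj₂ (remQuot {2} 2 t′)) b≈b′))

      complete : ∀ t → System F l κ t → Σ (Fin 4) λ s → _≈³_ F (v s) t
      complete t sys with solution-complete t sys
      ... | i , j , sol≈t =
        combine i j , ≡.subst (λ p → _≈³_ F (uncurry solution p) t) (≡.sym (remQuot-combine i j)) sol≈t

open import Data.Nat using (_+_; _*_; _^_)
open import Data.Nat.Tactic.RingSolver using (solve-∀)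

2^[m+1]²≡2^[2m+1]*2 : ∀ m → 2 ^ (m + 1) * 2 ^ (m + 1) ≡ 2 ^ (2 * m + 1) * 2
2^[m+1]²≡2^[2m+1]*2 m = begin
  2 ^ (m + 1) * 2 ^ (m + 1)  ≡⟨ ℕ.^-distribˡ-+-* 2 (m + 1) (m + 1) ⟨
  2 ^ ((m + 1) + (m + 1))    ≡⟨ ≡.cong (2 ^_) (exponents m) ⟩
  2 ^ ((2 * m + 1) + 1)      ≡⟨ ℕ.^-distribˡ-+-* 2 (2 * m + 1) 1 ⟩
  2 ^ (2 * m + 1) * 2        ∎
  where
  open ≡.≡-Reasoning
  exponents : ∀ m → (m + 1) + (m + 1) ≡ (2 * m + 1) + 1
  exponents = solve-∀

lemma3p1 : {c ℓ : Level} (m : ℕ) (F : CommutativeRing c ℓ) →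
           IsFiniteFieldOfOrder F (2 ^ (2 * m + 1)) →
           (κ : CommutativeRing.Carrier F) → ¬ (CommutativeRing._≈_ F κ (CommutativeRing.0# F)) →
           ExactlyNSolutions F 4 (System F (2 ^ (m + 1)) κ)
lemma3p1 m F isFiniteField κ κ≉0 =
  Solutions.exactlyFour F isField _≟_
    (m^k-order⇒m×1≈0 F isField 2 (2 * m + 1) card)
    (2 ^ (m + 1)) ⦃ ℕ.m^n≢0 2 (m + 1) ⦄ κ≉0
    (^[1+ℓ]^ℓ≈^[2+ℓ] F (2 ^ (2 * m + 1)) (2 ^ (m + 1)) (fermat κ≉0) (2^[m+1]²≡2^[2m+1]*2 m))
  where
  open IsFiniteFieldOfOrder isFiniteField
  open Enumeration F card using (_≟_)
  open FiniteField F isField card using (fermat)
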